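{- For all finite simple undirected graphs $G$ and $H$, the following are equivalent: (i) $\hom(P,G)=\hom(P,H)$ for every path $P$; (ii) the system $\mathsf{F}_{\mathrm{iso}}(G,H)$ of linear equations has a real solution.
   Context: $\hom(F,G)$ denotes the number of homomorphisms from $F$ to $G$, i.e. maps $h:V(F)\to V(G)$ with $h(u)h(v)\in E(G)$ for all $uv\in E(F)$. Paths include the one-vertex path; $P_\ell$ denotes the path with $\ell$ edges. Let $V=V(G)$, $W=V(H)$, and let $A\in\{0,1\}^{V\times V}$, $B\in\{0,1\}^{W\times W}$ be the adjacency matrices. $\mathsf{F}_{\mathrm{iso}}(G,H)$ is the system in the variables $X=(X_{vw})_{v\in V,w\in W}$ given by $AX=XB$, $X\mathbf 1_W=\mathbf 1_V$, $\mathbf 1_V^TX=\mathbf 1_W^T$, where $\mathbf 1_U$ is the all-ones vector indexed by $U$.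
   Formalization: The system $\mathsf{F}_{\mathrm{iso}}(G,H)$ is solved over the rationals rather than the reals, its variables taking rational values. -}

module Defs where

open import Data.Nat using (ℕ; zero; suc)
open import Data.Nat.Base using (∣_-_∣)
open import Data.Fin using (Fin; toℕ)
open import Data.Bool using (Bool; true; false; if_then_else_; _∧_; _∨_; not)
open import Data.List using (List; []; _∷_; concatMap; map; filter; length)
open import Data.Bool.ListAction using (and)
open import Data.List.Base using (allFin)
open import Data.Rational using (ℚ; 0ℚ; 1ℚ; _+_; _*_)
open import Relation.Binary.PropositionalEquality using (_≡_)
open import Data.Product using (Σ; _×_)

record Graph (n : ℕ) : Set where
  field
    adj       : Fin n → Fin n → Bool
    symmetric : ∀ u v → adj u v ≡ adj v u
    loopless  : ∀ u → adj u u ≡ false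
open Graph public

allMaps : (k n : ℕ) → List (Fin k → Fin n)
allMaps zero    n = (λ ()) ∷ []
allMaps (suc k) n =
  concatMap (λ x → map (λ f → λ { Fin.zero → x ; (Fin.suc i) → f i }) (allMaps k n))
            (allFin n)

isHom : ∀ {k n} → Graph k → Graph n → (Fin k → Fin n) → Bool
isHom {k} F G h =
  and (map (λ u → and (map (λ v → not (adj F u v) ∨ adj G (h u) (h v)) (allFin k))) (allFin k))

hom : ∀ {k n} → Graph k → Graph n → ℕ
hom {k} {n} F G = length (filter (λ h → isHom F G h Data.Bool.≟ true) (allMaps k n))
  where import Data.Bool

pathAdj : ∀ ℓ → Fin (suc ℓ) → Fin (suc ℓ) → Bool
pathAdj ℓ i j = ∣ toℕ i - toℕ j ∣ Data.Nat.≡ᵇ 1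
  where import Data.Nat

P : (ℓ : ℕ) → Graph (suc ℓ)
P ℓ = record { adj = pathAdj ℓ ; symmetric = sym' ; loopless = loop' }
  where
    open import Data.Nat.Properties using (∣-∣-comm; n∸n≡0)
    open import Relation.Binary.PropositionalEquality using (cong; refl)
    sym' : ∀ u v → pathAdj ℓ u v ≡ pathAdj ℓ v u
    sym' u v = cong (λ z → z Data.Nat.≡ᵇ 1) (∣-∣-comm (toℕ u) (toℕ v))
      where import Data.Nat
    loop' : ∀ u → pathAdj ℓ u u ≡ false
    loop' u rewrite Data.Nat.Properties.∣n-n∣≡0 (toℕ u) = refl
      where import Data.Nat.Properties

Σℚ : ∀ {n} → (Fin n → ℚ) → ℚ
Σℚ {zero}  f = 0ℚ
Σℚ {suc n} f = f Fin.zero + Σℚ (λ i → f (Fin.suc i))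

toℚ : Bool → ℚ
toℚ b = if b then 1ℚ else 0ℚ

IsFisoSolution : ∀ {n m} → Graph n → Graph m → (Fin n → Fin m → ℚ) → Set
IsFisoSolution G H X =
  (∀ v w → Σℚ (λ u → toℚ (adj G v u) * X u w) ≡ Σℚ (λ x → X v x * toℚ (adj H x w)))
  × (∀ v → Σℚ (λ w → X v w) ≡ 1ℚ)
  × (∀ w → Σℚ (λ v → X v w) ≡ 1ℚ)

{-# OPTIONS --safe #-}
module Submission where

-- Write A, B for the adjacency matrices of G, H.  Counting homomorphisms from a path by
-- the image of its first vertex gives hom(P ℓ, G) = 1ᵀ Aˡ 1.
--
-- (ii) ⇒ (i): AX = XB gives Aˡ X = X Bˡ, so with X 1 = 1 and 1ᵀ X = 1ᵀ we get
-- 1ᵀ Aˡ 1 = 1ᵀ Aˡ X 1 = 1ᵀ X Bˡ 1 = 1ᵀ Bˡ 1.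
--
-- (i) ⇒ (ii): run the Lanczos process on (A, 1): e₀ = 1 and e_{k+1} = A e_k - α_k e_k - β_k e_{k-1},
-- with α_k, β_k chosen to make the e_k pairwise orthogonal; by Bessel's inequality some e_N
-- with N ≤ n vanishes.  The same recurrence with the same coefficients, run on (B, 1), gives
-- vectors f_k whose Gram data ⟨f_i, Bˡ f_j⟩ agree with ⟨e_i, Aˡ e_j⟩, because both are
-- determined by the coefficients and the moments 1ᵀ Aˡ 1 = 1ᵀ Bˡ 1.  So the f_k are orthogonal
-- too, f_N = 0, and X = Σ_{k<N} e_k f_kᵀ / ‖e_k‖² solves the system: by the three-term
-- recurrence AX - XB telescopes to 0, and orthogonality to e₀ = 1 and f₀ = 1 gives the row and
-- column sums.

open import Defs
open import Algebra.Bundles using (CommutativeRing)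
import Algebra.Definitions.RawMonoid
open import Data.Bool using (Bool; true; false; T; _∧_; _∨_; not)
import Data.Bool as Bool
open import Data.Bool.Properties using (T-∧)
open import Data.Bool.ListAction using (and; all)
open import Data.Empty using (⊥-elim)
open import Data.Fin using (Fin; zero; suc; toℕ)
open import Data.Fin.Properties using (any?)
open import Data.List using (List; []; _∷_; _++_; map; concatMap; tabulate; allFin; filter; length)
open import Data.List.Properties using (map-cong)
open import Data.List.Relation.Unary.All.Properties using (all⁺; all⁻; tabulate⁺; tabulate⁻)
open import Data.Maybe using (just; nothing)
open import Data.Nat using (ℕ; zero; suc; _<_; _≤_; s≤s; z≤n)
import Data.Nat.Properties as ℕₚ
open import Data.Product using (_×_; _,_; proj₁; proj₂; ∃)
open import Data.Rational using (ℚ; 0ℚ; 1ℚ; _+_; _*_; _-_; -_; 1/_; ≢-nonZero; nonNegative; nonPositive)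
  renaming (_≤_ to _≤ℚ_)
import Data.Rational.Properties as ℚₚ
open import Data.Sum using (inj₁; inj₂)
open import Data.Vec.Functional using (Vector) renaming (_∷_ to _∷ᵥ_)
open import Function using (_∘_; id; _⇔_; mk⇔; Equivalence)
open import Relation.Binary.PropositionalEquality
open import Relation.Nullary using (yes; no; ¬_)
open import Tactic.RingSolver using (solve-∀)
open import Tactic.RingSolver.Core.AlmostCommutativeRing using (AlmostCommutativeRing; fromCommutativeRing)

open import Algebra.Properties.Semiring.Sum (CommutativeRing.semiring ℚₚ.+-*-commutativeRing)
open Algebra.Definitions.RawMonoid ℚₚ.+-rawMonoid using () renaming (_×_ to _×ℚ_)
open ≡-Reasoning

ℚ-ring : AlmostCommutativeRing _ _
ℚ-ring = fromCommutativeRing ℚₚ.+-*-commutativeRing isZero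
  where
  isZero : ∀ p → _
  isZero p with 0ℚ ℚₚ.≟ p
  ... | yes 0≡p = just 0≡p
  ... | no _    = nothing

-- Total inverse: inv 0ℚ = 0ℚ.
inv : ℚ → ℚ
inv q with q ℚₚ.≟ 0ℚ
... | yes _   = 0ℚ
... | no q≢0 = 1/_ q {{≢-nonZero q≢0}}

*-inv-cancel : ∀ {p q} → (q ≡ 0ℚ → p ≡ 0ℚ) → p * inv q * q ≡ p
*-inv-cancel {p} {q} p≡0 with q ℚₚ.≟ 0ℚ
... | yes q≡0 = trans (annihilate p q) (sym (p≡0 q≡0))
  where
  annihilate : ∀ p q → p * 0ℚ * q ≡ 0ℚ
  annihilate = solve-∀ ℚ-ring
... | no q≢0 = begin
  p * 1/_ q {{≢-nonZero q≢0}} * q    ≡⟨ ℚₚ.*-assoc p _ q ⟩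
  p * (1/_ q {{≢-nonZero q≢0}} * q)  ≡⟨ cong (p *_) (ℚₚ.*-inverseˡ q {{≢-nonZero q≢0}}) ⟩
  p * 1ℚ                             ≡⟨ ℚₚ.*-identityʳ p ⟩
  p                                  ∎

*-inv-inverse : ∀ {q} → q ≢ 0ℚ → q * inv q ≡ 1ℚ
*-inv-inverse {q} q≢0 = begin
  q * inv q       ≡⟨ ℚₚ.*-comm q (inv q) ⟩
  inv q * q       ≡⟨ cong (_* q) (ℚₚ.*-identityˡ (inv q)) ⟨
  1ℚ * inv q * q  ≡⟨ *-inv-cancel (⊥-elim ∘ q≢0) ⟩
  1ℚ              ∎

square-nonneg : ∀ p → 0ℚ ≤ℚ p * p
square-nonneg p with ℚₚ.≤-total 0ℚ p
... | inj₁ 0≤p = subst (_≤ℚ p * p) (ℚₚ.*-zeroʳ p) (ℚₚ.*-monoˡ-≤-nonNeg p {{nonNegative 0≤p}} 0≤p)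
... | inj₂ p≤0 = subst (_≤ℚ p * p) (ℚₚ.*-zeroʳ p) (ℚₚ.*-monoˡ-≤-nonPos p {{nonPositive p≤0}} p≤0)

square≡0⇒≡0 : ∀ {p} → p * p ≡ 0ℚ → p ≡ 0ℚ
square≡0⇒≡0 {p} p²≡0 with p ℚₚ.≟ 0ℚ
... | yes p≡0 = p≡0
... | no p≢0  = begin
  p              ≡⟨ *-inv-cancel (⊥-elim ∘ p≢0) ⟨
  p * inv p * p  ≡⟨ reorder p (inv p) ⟩
  p * p * inv p  ≡⟨ cong (_* inv p) p²≡0 ⟩
  0ℚ * inv p     ≡⟨ ℚₚ.*-zeroˡ (inv p) ⟩
  0ℚ             ∎
  where
  reorder : ∀ p q → p * q * p ≡ p * p * q
  reorder = solve-∀ ℚ-ring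

nonneg-+≡0⇒≡0 : ∀ {p q} → 0ℚ ≤ℚ p → 0ℚ ≤ℚ q → p + q ≡ 0ℚ → p ≡ 0ℚ
nonneg-+≡0⇒≡0 {p} {q} p≥0 q≥0 p+q≡0 = ℚₚ.≤-antisym p≤0 p≥0
  where
  p≤0 : p ≤ℚ 0ℚ
  p≤0 = subst₂ _≤ℚ_ (ℚₚ.+-identityʳ p) p+q≡0 (ℚₚ.+-monoʳ-≤ p q≥0)

1+p≰p : ∀ p → ¬ (1ℚ + p ≤ℚ p)
1+p≰p p 1+p≤p = ℚₚ.1≢0 (ℚₚ.≤-antisym 1≤0 (ℚₚ.nonNegative⁻¹ 1ℚ))
  where
  cancel : ∀ p → 1ℚ + p - p ≡ 1ℚ
  cancel = solve-∀ ℚ-ring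
  1≤0 : 1ℚ ≤ℚ 0ℚ
  1≤0 = subst₂ _≤ℚ_ (cancel p) (ℚₚ.+-inverseʳ p) (ℚₚ.+-monoˡ-≤ (- p) 1+p≤p)

fromℕ : ℕ → ℚ
fromℕ k = k ×ℚ 1ℚ

fromℕ-nonneg : ∀ k → 0ℚ ≤ℚ fromℕ k
fromℕ-nonneg zero    = ℚₚ.≤-refl
fromℕ-nonneg (suc k) =
  subst (_≤ℚ fromℕ (suc k)) (ℚₚ.+-identityʳ 0ℚ) (ℚₚ.+-mono-≤ (ℚₚ.nonNegative⁻¹ 1ℚ) (fromℕ-nonneg k))

fromℕ-injective : ∀ {a b} → fromℕ a ≡ fromℕ b → a ≡ b
fromℕ-injective {zero}  {zero}  _  = refl
fromℕ-injective {zero}  {suc b} eq = ⊥-elim (1+p≰p (fromℕ b) (subst (_≤ℚ fromℕ b) eq (fromℕ-nonneg b)))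
fromℕ-injective {suc a} {zero}  eq = ⊥-elim (1+p≰p (fromℕ a) (subst (_≤ℚ fromℕ a) (sym eq) (fromℕ-nonneg a)))
fromℕ-injective {suc a} {suc b} eq = cong suc (fromℕ-injective (begin
  fromℕ a                ≡⟨ cancel (fromℕ a) ⟨
  - 1ℚ + (1ℚ + fromℕ a)  ≡⟨ cong (- 1ℚ +_) eq ⟩
  - 1ℚ + (1ℚ + fromℕ b)  ≡⟨ cancel (fromℕ b) ⟩
  fromℕ b                ∎))
  where
  cancel : ∀ p → - 1ℚ + (1ℚ + p) ≡ p
  cancel = solve-∀ ℚ-ring

-- Finite sums

Σℚ≡sum : ∀ {n} (f : Vector ℚ n) → Σℚ f ≡ sum f
Σℚ≡sum {zero}  f = refl
Σℚ≡sum {suc n} f = cong (f zero +_) (Σℚ≡sum (f ∘ suc))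

sum-zero : ∀ {n} {f : Vector ℚ n} → (∀ i → f i ≡ 0ℚ) → sum f ≡ 0ℚ
sum-zero {n} f≗0 = trans (sum-cong-≗ f≗0) (sum-replicate-zero n)

sum-nonneg : ∀ {n} {f : Vector ℚ n} → (∀ i → 0ℚ ≤ℚ f i) → 0ℚ ≤ℚ sum f
sum-nonneg {zero}  _   = ℚₚ.≤-refl
sum-nonneg {suc n} f≥0 = ℚₚ.+-mono-≤ (f≥0 zero) (sum-nonneg (f≥0 ∘ suc))

sum-mono-≤ : ∀ {n} {f g : Vector ℚ n} → (∀ i → f i ≤ℚ g i) → sum f ≤ℚ sum g
sum-mono-≤ {zero}  _   = ℚₚ.≤-refl
sum-mono-≤ {suc n} f≤g = ℚₚ.+-mono-≤ (f≤g zero) (sum-mono-≤ (f≤g ∘ suc))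

sum≡0⇒≡0 : ∀ {n} {f : Vector ℚ n} → (∀ i → 0ℚ ≤ℚ f i) → sum f ≡ 0ℚ → ∀ i → f i ≡ 0ℚ
sum≡0⇒≡0 {suc n} {f} f≥0 Σf≡0 zero    = nonneg-+≡0⇒≡0 (f≥0 zero) (sum-nonneg (f≥0 ∘ suc)) Σf≡0
sum≡0⇒≡0 {suc n} {f} f≥0 Σf≡0 (suc i) = sum≡0⇒≡0 (f≥0 ∘ suc) Σtail≡0 i
  where
  Σtail≡0 : sum (f ∘ suc) ≡ 0ℚ
  Σtail≡0 = nonneg-+≡0⇒≡0 (sum-nonneg (f≥0 ∘ suc)) (f≥0 zero) (trans (ℚₚ.+-comm _ (f zero)) Σf≡0)

∑-first : ∀ {N} → 0 < N → (a : ℕ → ℚ) → (∀ k → 0 < k → a k ≡ 0ℚ) → ∑[ k < N ] a (toℕ k) ≡ a 0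
∑-first {suc N} _ a rest =
  trans (cong (a 0 +_) (sum-zero {N} (λ k → rest (suc (toℕ k)) (s≤s z≤n)))) (ℚₚ.+-identityʳ (a 0))

∑-outer : ∀ {m N} (a : Vector ℚ N) (b : Fin N → Vector ℚ m) →
          ∑[ w < m ] ∑[ k < N ] (a k * b k w) ≡ ∑[ k < N ] (a k * sum (b k))
∑-outer a b = trans (∑-comm (λ w k → a k * b k w)) (sum-cong-≗ (λ k → sym (*-distribˡ-sum (a k) (b k))))

∑-telescope : ∀ N (f g d : ℕ → ℚ) → (∀ k → f k ≡ g k + (d (suc k) - d k)) →
              ∑[ k < N ] f (toℕ k) ≡ ∑[ k < N ] g (toℕ k) + (d N - d 0)
∑-telescope zero    f g d step = collapse (d 0)
  where
  collapse : ∀ x → 0ℚ ≡ 0ℚ + (x - x)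
  collapse = solve-∀ ℚ-ring
∑-telescope (suc N) f g d step = begin
  f 0 + ∑[ k < N ] f (suc (toℕ k))
    ≡⟨ cong₂ _+_ (step 0) (∑-telescope N (f ∘ suc) (g ∘ suc) (d ∘ suc) (step ∘ suc)) ⟩
  (g 0 + (d 1 - d 0)) + (∑[ k < N ] g (suc (toℕ k)) + (d (suc N) - d 1))
    ≡⟨ regroup (g 0) _ (d 0) (d 1) (d (suc N)) ⟩
  (g 0 + ∑[ k < N ] g (suc (toℕ k))) + (d (suc N) - d 0)
    ∎
  where
  regroup : ∀ a b x y z → (a + (y - x)) + (b + (z - y)) ≡ (a + b) + (z - x)
  regroup = solve-∀ ℚ-ring

∑∑-assoc : ∀ {m n} (a : Vector ℚ m) (M : Fin m → Fin n → ℚ) (b : Vector ℚ n) →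
           ∑[ i < m ] (a i * ∑[ j < n ] (M i j * b j)) ≡ ∑[ j < n ] (∑[ i < m ] (a i * M i j) * b j)
∑∑-assoc {m} {n} a M b = begin
  ∑[ i < m ] (a i * ∑[ j < n ] (M i j * b j))
    ≡⟨ sum-cong-≗ (λ i → *-distribˡ-sum (a i) (λ j → M i j * b j)) ⟩
  ∑[ i < m ] ∑[ j < n ] (a i * (M i j * b j))
    ≡⟨ ∑-comm (λ i j → a i * (M i j * b j)) ⟩
  ∑[ j < n ] ∑[ i < m ] (a i * (M i j * b j))
    ≡⟨ sum-cong-≗ (λ j → sum-cong-≗ (λ i → ℚₚ.*-assoc (a i) (M i j) (b j))) ⟨
  ∑[ j < n ] ∑[ i < m ] (a i * M i j * b j)
    ≡⟨ sum-cong-≗ (λ j → *-distribʳ-sum (b j) (λ i → a i * M i j)) ⟨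
  ∑[ j < n ] (∑[ i < m ] (a i * M i j) * b j)
    ∎

-- Inner products

infixl 6 _⊖_⊛_
infix  8 _∙_

0ᵥ : ∀ {n} → Vector ℚ n
0ᵥ _ = 0ℚ

ones : ∀ {n} → Vector ℚ n
ones _ = 1ℚ

basis : ∀ {n} → Fin n → Vector ℚ n
basis zero    zero    = 1ℚ
basis zero    (suc _) = 0ℚ
basis (suc i) zero    = 0ℚ
basis (suc i) (suc j) = basis i j

_⊖_⊛_ : ∀ {n} → Vector ℚ n → ℚ → Vector ℚ n → Vector ℚ n
(x ⊖ a ⊛ y) i = x i - a * y i

_∙_ : ∀ {n} → Vector ℚ n → Vector ℚ n → ℚ
_∙_ {n} x y = ∑[ i < n ] (x i * y i)

∥_∥² : ∀ {n} → Vector ℚ n → ℚ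
∥ x ∥² = x ∙ x

basis∙ : ∀ {n} i (x : Vector ℚ n) → basis i ∙ x ≡ x i
basis∙ zero    x = trans (cong₂ _+_ (ℚₚ.*-identityˡ (x zero)) (sum-zero (λ j → ℚₚ.*-zeroˡ (x (suc j)))))
                         (ℚₚ.+-identityʳ (x zero))
basis∙ (suc i) x = trans (cong₂ _+_ (ℚₚ.*-zeroˡ (x zero)) (basis∙ i (x ∘ suc))) (ℚₚ.+-identityˡ (x (suc i)))

basis-diag : ∀ {n} (i : Fin n) → basis i i ≡ 1ℚ
basis-diag zero    = refl
basis-diag (suc i) = basis-diag i

∥basis∥² : ∀ {n} (i : Fin n) → ∥ basis i ∥² ≡ 1ℚ
∥basis∥² i = trans (basis∙ i (basis i)) (basis-diag i)

module _ {n : ℕ} where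

  ∙-comm : ∀ (x y : Vector ℚ n) → x ∙ y ≡ y ∙ x
  ∙-comm x y = sum-cong-≗ (λ i → ℚₚ.*-comm (x i) (y i))

  ∙-congʳ : ∀ (x : Vector ℚ n) {y y′} → y ≗ y′ → x ∙ y ≡ x ∙ y′
  ∙-congʳ x y≗y′ = sum-cong-≗ (λ i → cong (x i *_) (y≗y′ i))

  ∙-zeroˡ : ∀ (x y : Vector ℚ n) → x ≗ 0ᵥ → x ∙ y ≡ 0ℚ
  ∙-zeroˡ x y x≗0 = sum-zero (λ i → trans (cong (_* y i) (x≗0 i)) (ℚₚ.*-zeroˡ (y i)))

  ones∙ : ∀ (y : Vector ℚ n) → ones ∙ y ≡ sum y
  ones∙ y = sum-cong-≗ (λ i → ℚₚ.*-identityˡ (y i))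

  ∙-⊖ʳ : ∀ (z x : Vector ℚ n) a y → z ∙ (x ⊖ a ⊛ y) ≡ z ∙ x - a * z ∙ y
  ∙-⊖ʳ z x a y = begin
    ∑[ i < n ] (z i * (x i - a * y i))            ≡⟨ sum-cong-≗ (λ i → spread (z i) (x i) a (y i)) ⟩
    ∑[ i < n ] (z i * x i + (- a) * (z i * y i))  ≡⟨ ∑-distrib-+ (λ i → z i * x i) (λ i → (- a) * (z i * y i)) ⟩
    z ∙ x + ∑[ i < n ] ((- a) * (z i * y i))      ≡⟨ cong (z ∙ x +_) (*-distribˡ-sum (- a) (λ i → z i * y i)) ⟨
    z ∙ x + (- a) * z ∙ y                         ≡⟨ collect (z ∙ x) a (z ∙ y) ⟩
    z ∙ x - a * z ∙ y                             ∎
    where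
    spread : ∀ z x a y → z * (x - a * y) ≡ z * x + (- a) * (z * y)
    spread = solve-∀ ℚ-ring
    collect : ∀ p a q → p + (- a) * q ≡ p - a * q
    collect = solve-∀ ℚ-ring

  ∙-⊖ˡ : ∀ (x : Vector ℚ n) a y z → (x ⊖ a ⊛ y) ∙ z ≡ x ∙ z - a * y ∙ z
  ∙-⊖ˡ x a y z = begin
    (x ⊖ a ⊛ y) ∙ z    ≡⟨ ∙-comm _ z ⟩
    z ∙ (x ⊖ a ⊛ y)    ≡⟨ ∙-⊖ʳ z x a y ⟩
    z ∙ x - a * z ∙ y  ≡⟨ cong₂ (λ p q → p - a * q) (∙-comm z x) (∙-comm z y) ⟩
    x ∙ z - a * y ∙ z  ∎

  ∥∥²-nonneg : ∀ (x : Vector ℚ n) → 0ℚ ≤ℚ ∥ x ∥²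
  ∥∥²-nonneg x = sum-nonneg (λ i → square-nonneg (x i))

  ∥∥²≡0⇒≗0 : ∀ (x : Vector ℚ n) → ∥ x ∥² ≡ 0ℚ → x ≗ 0ᵥ
  ∥∥²≡0⇒≗0 x ∥x∥²≡0 i = square≡0⇒≡0 (sum≡0⇒≡0 (λ j → square-nonneg (x j)) ∥x∥²≡0 i)

  ∥∥²≡0⇒∙≡0 : ∀ (x y : Vector ℚ n) → ∥ x ∥² ≡ 0ℚ → x ∙ y ≡ 0ℚ
  ∥∥²≡0⇒∙≡0 x y ∥x∥²≡0 = ∙-zeroˡ x y (∥∥²≡0⇒≗0 x ∥x∥²≡0)

PairwiseOrthogonal : ∀ {n} → (ℕ → Vector ℚ n) → Set
PairwiseOrthogonal g = ∀ {t k} → t < k → g t ∙ g k ≡ 0ℚ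

-- Bessel's inequality

module _ {n : ℕ} where

  projectOut : Vector ℚ n → Vector ℚ n → Vector ℚ n
  projectOut g x = x ⊖ x ∙ g * inv ∥ g ∥² ⊛ g

  projectOut-⊥ : ∀ g x → projectOut g x ∙ g ≡ 0ℚ
  projectOut-⊥ g x = begin
    projectOut g x ∙ g                   ≡⟨ ∙-⊖ˡ x (x ∙ g * inv ∥ g ∥²) g g ⟩
    x ∙ g - x ∙ g * inv ∥ g ∥² * ∥ g ∥²  ≡⟨ cong (λ q → x ∙ g - q) (*-inv-cancel x∙g≡0) ⟩
    x ∙ g - x ∙ g                        ≡⟨ ℚₚ.+-inverseʳ (x ∙ g) ⟩
    0ℚ                                   ∎
    where
    x∙g≡0 : ∥ g ∥² ≡ 0ℚ → x ∙ g ≡ 0ℚ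
    x∙g≡0 ∥g∥²≡0 = trans (∙-comm x g) (∥∥²≡0⇒∙≡0 g x ∥g∥²≡0)

  projectOut-∙ : ∀ g x h → g ∙ h ≡ 0ℚ → projectOut g x ∙ h ≡ x ∙ h
  projectOut-∙ g x h g∙h≡0 = begin
    projectOut g x ∙ h                  ≡⟨ ∙-⊖ˡ x (x ∙ g * inv ∥ g ∥²) g h ⟩
    x ∙ h - x ∙ g * inv ∥ g ∥² * g ∙ h  ≡⟨ cong (λ q → x ∙ h - x ∙ g * inv ∥ g ∥² * q) g∙h≡0 ⟩
    x ∙ h - x ∙ g * inv ∥ g ∥² * 0ℚ     ≡⟨ drop-zero (x ∙ h) (x ∙ g * inv ∥ g ∥²) ⟩
    x ∙ h                               ∎
    where
    drop-zero : ∀ p d → p - d * 0ℚ ≡ p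
    drop-zero = solve-∀ ℚ-ring

  ∥projectOut∥² : ∀ g x → ∥ projectOut g x ∥² ≡ ∥ x ∥² - x ∙ g * inv ∥ g ∥² * x ∙ g
  ∥projectOut∥² g x = begin
    x′ ∙ x′                      ≡⟨ ∙-⊖ˡ x d g x′ ⟩
    x ∙ x′ - d * g ∙ x′          ≡⟨ cong₂ (λ p q → p - d * q) (∙-⊖ʳ x x d g) (trans (∙-comm g x′) (projectOut-⊥ g x)) ⟩
    ∥ x ∥² - d * x ∙ g - d * 0ℚ  ≡⟨ drop-zero (∥ x ∥² - d * x ∙ g) d ⟩
    ∥ x ∥² - d * x ∙ g           ∎
    where
    x′ = projectOut g x
    d  = x ∙ g * inv ∥ g ∥²
    drop-zero : ∀ p d → p - d * 0ℚ ≡ p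
    drop-zero = solve-∀ ℚ-ring

  bessel : ∀ K {g : ℕ → Vector ℚ n} → PairwiseOrthogonal g → ∀ x →
           ∑[ k < K ] (x ∙ g (toℕ k) * inv ∥ g (toℕ k) ∥² * x ∙ g (toℕ k)) ≤ℚ ∥ x ∥²
  bessel zero    _                  x = ∥∥²-nonneg x
  bessel (suc K) {g} g-orthogonal x = subst₂ _≤ℚ_ (cong (t₀ +_) tail-unchanged) restore
    (ℚₚ.+-monoʳ-≤ t₀ (bessel K {g ∘ suc} (g-orthogonal ∘ s≤s) x′))
    where
    x′ = projectOut (g 0) x
    term : Vector ℚ n → Vector ℚ n → ℚ
    term y h = y ∙ h * inv ∥ h ∥² * y ∙ h
    t₀ = term x (g 0)
    tail-unchanged : ∑[ k < K ] term x′ (g (suc (toℕ k))) ≡ ∑[ k < K ] term x (g (suc (toℕ k)))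
    tail-unchanged = sum-cong-≗ {K} (λ k → cong (λ p → p * inv ∥ g (suc (toℕ k)) ∥² * p)
                                                 (projectOut-∙ (g 0) x _ (g-orthogonal (s≤s z≤n))))
    restore : t₀ + ∥ x′ ∥² ≡ ∥ x ∥²
    restore = trans (cong (t₀ +_) (∥projectOut∥² (g 0) x)) (cancel t₀ ∥ x ∥²)
      where
      cancel : ∀ t p → t + (p - t) ≡ p
      cancel = solve-∀ ℚ-ring

  ∑-bessel-basis : ∀ K {g : ℕ → Vector ℚ n} → PairwiseOrthogonal g →
                   ∑[ i < n ] ∑[ k < K ] (g (toℕ k) i * inv ∥ g (toℕ k) ∥² * g (toℕ k) i) ≤ℚ fromℕ n
  ∑-bessel-basis K {g} g-orthogonal = ℚₚ.≤-trans (sum-mono-≤ per-vertex) (ℚₚ.≤-reflexive (sum-replicate n {1ℚ}))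
    where
    at : ∀ i → ∑[ k < K ] (basis i ∙ g (toℕ k) * inv ∥ g (toℕ k) ∥² * basis i ∙ g (toℕ k))
             ≡ ∑[ k < K ] (g (toℕ k) i * inv ∥ g (toℕ k) ∥² * g (toℕ k) i)
    at i = sum-cong-≗ {K} (λ k → cong₂ (λ p q → p * inv ∥ g (toℕ k) ∥² * q)
                                       (basis∙ i (g (toℕ k))) (basis∙ i (g (toℕ k))))
    per-vertex : ∀ i → ∑[ k < K ] (g (toℕ k) i * inv ∥ g (toℕ k) ∥² * g (toℕ k) i) ≤ℚ 1ℚ
    per-vertex i = ℚₚ.≤-trans (ℚₚ.≤-reflexive (sym (at i)))
                              (ℚₚ.≤-trans (bessel K {g} g-orthogonal (basis i)) (ℚₚ.≤-reflexive (∥basis∥² i)))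

  ∑-normalised : ∀ K (g : ℕ → Vector ℚ n) → (∀ (k : Fin K) → ∥ g (toℕ k) ∥² ≢ 0ℚ) →
                 ∑[ i < n ] ∑[ k < K ] (g (toℕ k) i * inv ∥ g (toℕ k) ∥² * g (toℕ k) i) ≡ fromℕ K
  ∑-normalised K g nonzero = begin
    ∑[ i < n ] ∑[ k < K ] (g (toℕ k) i * inv ∥ g (toℕ k) ∥² * g (toℕ k) i)
      ≡⟨ ∑-comm {n} {K} (λ i k → g (toℕ k) i * inv ∥ g (toℕ k) ∥² * g (toℕ k) i) ⟩
    ∑[ k < K ] ∑[ i < n ] (g (toℕ k) i * inv ∥ g (toℕ k) ∥² * g (toℕ k) i)
      ≡⟨ sum-cong-≗ unit ⟩
    ∑[ k < K ] 1ℚ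
      ≡⟨ sum-replicate K {1ℚ} ⟩
    fromℕ K
      ∎
    where
    reorder : ∀ p q → p * q * p ≡ q * (p * p)
    reorder = solve-∀ ℚ-ring
    unit : ∀ k → ∑[ i < n ] (g (toℕ k) i * inv ∥ g (toℕ k) ∥² * g (toℕ k) i) ≡ 1ℚ
    unit k = begin
      ∑[ i < n ] (gₖ i * inv ∥ gₖ ∥² * gₖ i)    ≡⟨ sum-cong-≗ (λ i → reorder (gₖ i) (inv ∥ gₖ ∥²)) ⟩
      ∑[ i < n ] (inv ∥ gₖ ∥² * (gₖ i * gₖ i))  ≡⟨ *-distribˡ-sum (inv ∥ gₖ ∥²) (λ i → gₖ i * gₖ i) ⟨
      inv ∥ gₖ ∥² * ∥ gₖ ∥²                     ≡⟨ ℚₚ.*-comm (inv ∥ gₖ ∥²) ∥ gₖ ∥² ⟩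
      ∥ gₖ ∥² * inv ∥ gₖ ∥²                     ≡⟨ *-inv-inverse (nonzero k) ⟩
      1ℚ                                        ∎
      where
      gₖ = g (toℕ k)

  orthogonal-sequence-vanishes : ∀ {g : ℕ → Vector ℚ n} → PairwiseOrthogonal g → ∃ λ N → ∥ g N ∥² ≡ 0ℚ
  orthogonal-sequence-vanishes {g} g-orthogonal with any? (λ (k : Fin (suc n)) → ∥ g (toℕ k) ∥² ℚₚ.≟ 0ℚ)
  ... | yes (k , ∥g∥²≡0) = toℕ k , ∥g∥²≡0
  ... | no  none         = ⊥-elim (1+p≰p (fromℕ n) (subst (_≤ℚ fromℕ n)
    (∑-normalised (suc n) g (λ k ∥g∥²≡0 → none (k , ∥g∥²≡0))) (∑-bessel-basis (suc n) {g} g-orthogonal)))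

-- The adjacency action

infixr 9 _⊙_ _·_
infixl 10 _^_

_⊙_ : ∀ {m n} → (Fin m → Fin n → ℚ) → Vector ℚ n → Vector ℚ m
_⊙_ {n = n} M y i = ∑[ j < n ] (M i j * y j)

⊙-∑ : ∀ {m n N} (M : Fin m → Fin n → ℚ) (a : Fin N → Vector ℚ n) (s : Vector ℚ N) i →
      (M ⊙ (λ j → ∑[ k < N ] (a k j * s k))) i ≡ ∑[ k < N ] ((M ⊙ a k) i * s k)
⊙-∑ M a s i = ∑∑-assoc (M i) (λ j k → a k j) s

A[_] : ∀ {n} → Graph n → Fin n → Fin n → ℚ
A[ G ] u v = toℚ (adj G u v)

_·_ : ∀ {n} → Graph n → Vector ℚ n → Vector ℚ n
G · x = A[ G ] ⊙ x

_^_ : ∀ {n} → Graph n → ℕ → Vector ℚ n → Vector ℚ n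
(G ^ zero)  x = x
(G ^ suc ℓ) x = G · (G ^ ℓ) x

module _ {n} (G : Graph n) where

  ·-cong : ∀ {x y : Vector ℚ n} → x ≗ y → G · x ≗ G · y
  ·-cong x≗y v = sum-cong-≗ (λ u → cong (A[ G ] v u *_) (x≗y u))

  ^-cong : ∀ ℓ {x y : Vector ℚ n} → x ≗ y → (G ^ ℓ) x ≗ (G ^ ℓ) y
  ^-cong zero    x≗y = x≗y
  ^-cong (suc ℓ) x≗y = ·-cong (^-cong ℓ x≗y)

  ·-selfAdjoint : ∀ (x y : Vector ℚ n) → x ∙ G · y ≡ (G · x) ∙ y
  ·-selfAdjoint x y = begin
    ∑[ v < n ] (x v * ∑[ u < n ] (A[ G ] v u * y u))  ≡⟨ ∑∑-assoc x A[ G ] y ⟩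
    ∑[ u < n ] (∑[ v < n ] (x v * A[ G ] v u) * y u)  ≡⟨ sum-cong-≗ (λ u → cong (_* y u) (sum-cong-≗ (transposed u))) ⟩
    (G · x) ∙ y                                        ∎
    where
    transposed : ∀ u v → x v * A[ G ] v u ≡ A[ G ] u v * x v
    transposed u v = trans (ℚₚ.*-comm (x v) _) (cong (λ b → toℚ b * x v) (symmetric G v u))

  ^-comm : ∀ ℓ (x : Vector ℚ n) → (G ^ ℓ) (G · x) ≗ G · (G ^ ℓ) x
  ^-comm zero    x v = refl
  ^-comm (suc ℓ) x   = ·-cong (^-comm ℓ x)

  ^-selfAdjoint : ∀ ℓ (x y : Vector ℚ n) → x ∙ (G ^ ℓ) y ≡ (G ^ ℓ) x ∙ y
  ^-selfAdjoint zero    x y = refl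
  ^-selfAdjoint (suc ℓ) x y = begin
    x ∙ G · (G ^ ℓ) y      ≡⟨ ∙-congʳ x (^-comm ℓ y) ⟨
    x ∙ (G ^ ℓ) (G · y)    ≡⟨ ^-selfAdjoint ℓ x (G · y) ⟩
    (G ^ ℓ) x ∙ G · y      ≡⟨ ·-selfAdjoint ((G ^ ℓ) x) y ⟩
    (G · (G ^ ℓ) x) ∙ y    ∎

-- Three-term recurrences

threeTerm : ∀ {n} → Graph n → ℚ → ℚ → Vector ℚ n × Vector ℚ n → Vector ℚ n × Vector ℚ n
threeTerm G a b (p , x) = x , G · x ⊖ a ⊛ x ⊖ b ⊛ p

module Krylov {n} (G : Graph n) (α β : ℕ → ℚ) (x₀ : Vector ℚ n) where

  krylov : ℕ → Vector ℚ n × Vector ℚ n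
  krylov zero    = 0ᵥ , x₀
  krylov (suc k) = threeTerm G (α k) (β k) (krylov k)

  e prev : ℕ → Vector ℚ n
  e    = proj₂ ∘ krylov
  prev = proj₁ ∘ krylov

  ∙-e-suc : ∀ y k → y ∙ e (suc k) ≡ y ∙ G · e k - α k * y ∙ e k - β k * y ∙ prev k
  ∙-e-suc y k = trans (∙-⊖ʳ y (G · e k ⊖ α k ⊛ e k) (β k) (prev k))
                      (cong (_- β k * y ∙ prev k) (∙-⊖ʳ y (G · e k) (α k) (e k)))

  e-suc-∙ : ∀ k z → e (suc k) ∙ z ≡ e k ∙ G · z - α k * e k ∙ z - β k * prev k ∙ z
  e-suc-∙ k z = begin
    e (suc k) ∙ z
      ≡⟨ ∙-⊖ˡ (G · e k ⊖ α k ⊛ e k) (β k) (prev k) z ⟩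
    (G · e k ⊖ α k ⊛ e k) ∙ z - β k * prev k ∙ z
      ≡⟨ cong (_- β k * prev k ∙ z) (∙-⊖ˡ (G · e k) (α k) (e k) z) ⟩
    (G · e k) ∙ z - α k * e k ∙ z - β k * prev k ∙ z
      ≡⟨ cong (λ p → p - α k * e k ∙ z - β k * prev k ∙ z) (·-selfAdjoint G (e k) z) ⟨
    e k ∙ G · z - α k * e k ∙ z - β k * prev k ∙ z
      ∎

  e-∙-· : ∀ k z → e k ∙ G · z ≡ e (suc k) ∙ z + α k * e k ∙ z + β k * prev k ∙ z
  e-∙-· k z = trans (restore (e k ∙ G · z) _ _)
                    (cong (λ p → p + α k * e k ∙ z + β k * prev k ∙ z) (sym (e-suc-∙ k z)))
    where
    restore : ∀ m a b → m ≡ m - a - b + a + b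
    restore = solve-∀ ℚ-ring

  ·-e : ∀ k v → (G · e k) v ≡ e (suc k) v + α k * e k v + β k * prev k v
  ·-e k v = restore ((G · e k) v) (α k * e k v) (β k * prev k v)
    where
    restore : ∀ m a b → m ≡ m - a - b + a + b
    restore = solve-∀ ℚ-ring

  module Orthogonality
    (α-spec : ∀ k → α k * ∥ e k ∥² ≡ e k ∙ G · e k)
    (β-spec : ∀ k → β k * ∥ prev k ∥² ≡ prev k ∙ G · e k) where

    Orthogonal : ℕ → Set
    Orthogonal k = ∀ t → t < k → e t ∙ e k ≡ 0ℚ

    prev-⊥ : ∀ {k} → Orthogonal k → ∀ t → t ≤ k → prev t ∙ e k ≡ 0ℚ
    prev-⊥ {k} _  zero    _   = ∙-zeroˡ (prev zero) (e k) (λ _ → refl)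
    prev-⊥     ⊥k (suc t) t<k = ⊥k t t<k

    shift : ∀ {k} → Orthogonal k → ∀ t → t < k → e t ∙ G · e k ≡ e (suc t) ∙ e k
    shift {k} ⊥k t t<k = begin
      e t ∙ G · e k
        ≡⟨ e-∙-· t (e k) ⟩
      e (suc t) ∙ e k + α t * e t ∙ e k + β t * prev t ∙ e k
        ≡⟨ cong₂ (λ p q → e (suc t) ∙ e k + α t * p + β t * q) (⊥k t t<k) (prev-⊥ ⊥k t (ℕₚ.<⇒≤ t<k)) ⟩
      e (suc t) ∙ e k + α t * 0ℚ + β t * 0ℚ
        ≡⟨ drop-zeros _ (α t) (β t) ⟩
      e (suc t) ∙ e k
        ∎
      where
      drop-zeros : ∀ p a b → p + a * 0ℚ + b * 0ℚ ≡ p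
      drop-zeros = solve-∀ ℚ-ring

    ⊥-diag : ∀ {k} → Orthogonal k → e k ∙ e (suc k) ≡ 0ℚ
    ⊥-diag {k} ⊥k = begin
      e k ∙ e (suc k)
        ≡⟨ ∙-e-suc (e k) k ⟩
      e k ∙ G · e k - α k * ∥ e k ∥² - β k * e k ∙ prev k
        ≡⟨ cong₂ (λ p q → p - α k * ∥ e k ∥² - β k * q) (sym (α-spec k))
                 (trans (∙-comm (e k) (prev k)) (prev-⊥ ⊥k k ℕₚ.≤-refl)) ⟩
      α k * ∥ e k ∥² - α k * ∥ e k ∥² - β k * 0ℚ
        ≡⟨ cancel (α k * ∥ e k ∥²) (β k) ⟩
      0ℚ
        ∎
      where
      cancel : ∀ p b → p - p - b * 0ℚ ≡ 0ℚ
      cancel = solve-∀ ℚ-ring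

    ⊥-subdiag : ∀ {j} → Orthogonal (suc j) → e j ∙ e (suc (suc j)) ≡ 0ℚ
    ⊥-subdiag {j} ⊥j+1 = begin
      e j ∙ e (suc (suc j))
        ≡⟨ ∙-e-suc (e j) (suc j) ⟩
      e j ∙ G · e (suc j) - α (suc j) * e j ∙ e (suc j) - β (suc j) * ∥ e j ∥²
        ≡⟨ cong₂ (λ p q → e j ∙ G · e (suc j) - α (suc j) * p - q) (⊥j+1 j ℕₚ.≤-refl) (β-spec (suc j)) ⟩
      e j ∙ G · e (suc j) - α (suc j) * 0ℚ - e j ∙ G · e (suc j)
        ≡⟨ cancel (e j ∙ G · e (suc j)) (α (suc j)) ⟩
      0ℚ
        ∎
      where
      cancel : ∀ p a → p - a * 0ℚ - p ≡ 0ℚ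
      cancel = solve-∀ ℚ-ring

    ⊥-far : ∀ {j} → Orthogonal j → Orthogonal (suc j) → ∀ t → t < j → e t ∙ e (suc (suc j)) ≡ 0ℚ
    ⊥-far {j} ⊥j ⊥j+1 t t<j = begin
      e t ∙ e (suc (suc j))
        ≡⟨ ∙-e-suc (e t) (suc j) ⟩
      e t ∙ G · e (suc j) - α (suc j) * e t ∙ e (suc j) - β (suc j) * e t ∙ e j
        ≡⟨ cong₂ (λ p q → p - α (suc j) * q - β (suc j) * e t ∙ e j) (shift ⊥j+1 t t<1+j) (⊥j+1 t t<1+j) ⟩
      e (suc t) ∙ e (suc j) - α (suc j) * 0ℚ - β (suc j) * e t ∙ e j
        ≡⟨ cong₂ (λ p q → p - α (suc j) * 0ℚ - β (suc j) * q) (⊥j+1 (suc t) (s≤s t<j)) (⊥j t t<j) ⟩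
      0ℚ - α (suc j) * 0ℚ - β (suc j) * 0ℚ
        ≡⟨ cancel (α (suc j)) (β (suc j)) ⟩
      0ℚ
        ∎
      where
      t<1+j = ℕₚ.m<n⇒m<1+n t<j
      cancel : ∀ a b → 0ℚ - a * 0ℚ - b * 0ℚ ≡ 0ℚ
      cancel = solve-∀ ℚ-ring

    orthogonal₂ : ∀ k → Orthogonal k × Orthogonal (suc k)
    orthogonal₂ zero    = (λ _ ()) , λ { zero _ → ⊥-diag {0} (λ _ ()) ; (suc _) (s≤s ()) }
    orthogonal₂ (suc k) = ⊥k+1 , ⊥k+2
      where
      ⊥k   = proj₁ (orthogonal₂ k)
      ⊥k+1 = proj₂ (orthogonal₂ k)
      ⊥k+2 : Orthogonal (suc (suc k))
      ⊥k+2 t t<k+2 with ℕₚ.m<1+n⇒m<n∨m≡n t<k+2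
      ... | inj₂ refl = ⊥-diag ⊥k+1
      ... | inj₁ t<k+1 with ℕₚ.m<1+n⇒m<n∨m≡n t<k+1
      ...   | inj₂ refl = ⊥-subdiag ⊥k+1
      ...   | inj₁ t<k  = ⊥-far ⊥k ⊥k+1 t t<k

    orthogonal : PairwiseOrthogonal e
    orthogonal {t} {k} t<k = proj₁ (orthogonal₂ k) t t<k

    coupling : ∀ k → e k ∙ G · e (suc k) ≡ ∥ e (suc k) ∥²
    coupling k = shift (proj₁ (orthogonal₂ (suc k))) k ℕₚ.≤-refl

module _ {n m} (G : Graph n) (H : Graph m) (α β : ℕ → ℚ) (x₀ : Vector ℚ n) (y₀ : Vector ℚ m) where
  private
    module E = Krylov G α β x₀
    module F = Krylov H α β y₀

  krylov-moments : ∀ {y z} → (∀ ℓ → x₀ ∙ (G ^ ℓ) y ≡ y₀ ∙ (H ^ ℓ) z) →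
                   ∀ k ℓ → E.e k ∙ (G ^ ℓ) y ≡ F.e k ∙ (H ^ ℓ) z
  krylov-moments {y} {z} base k = proj₂ (agree k)
    where
    Agree : Vector ℚ n → Vector ℚ m → Set
    Agree x x′ = ∀ ℓ → x ∙ (G ^ ℓ) y ≡ x′ ∙ (H ^ ℓ) z
    agree : ∀ k → Agree (E.prev k) (F.prev k) × Agree (E.e k) (F.e k)
    agree zero    = (λ ℓ → trans (∙-zeroˡ (E.prev 0) ((G ^ ℓ) y) (λ _ → refl))
                                 (sym (∙-zeroˡ (F.prev 0) ((H ^ ℓ) z) (λ _ → refl))))
                  , base
    agree (suc k) = e≈f , λ ℓ → begin
      E.e (suc k) ∙ (G ^ ℓ) y
        ≡⟨ E.e-suc-∙ k _ ⟩
      E.e k ∙ (G ^ suc ℓ) y - α k * E.e k ∙ (G ^ ℓ) y - β k * E.prev k ∙ (G ^ ℓ) y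
        ≡⟨ combine (e≈f (suc ℓ)) (e≈f ℓ) (prev≈prev ℓ) ⟩
      F.e k ∙ (H ^ suc ℓ) z - α k * F.e k ∙ (H ^ ℓ) z - β k * F.prev k ∙ (H ^ ℓ) z
        ≡⟨ F.e-suc-∙ k _ ⟨
      F.e (suc k) ∙ (H ^ ℓ) z
        ∎
      where
      prev≈prev = proj₁ (agree k)
      e≈f       = proj₂ (agree k)
      combine : ∀ {p p′ q q′ r r′} → p ≡ p′ → q ≡ q′ → r ≡ r′ →
                p - α k * q - β k * r ≡ p′ - α k * q′ - β k * r′
      combine refl refl refl = refl

-- Counting homomorphisms from paths

count : ∀ {A : Set} → (A → Bool) → List A → ℚ
count p []       = 0ℚ
count p (a ∷ as) = toℚ (p a) + count p as

module _ {A : Set} where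

  fromℕ-length-filter : ∀ (p : A → Bool) xs → fromℕ (length (filter (λ a → p a Bool.≟ true) xs)) ≡ count p xs
  fromℕ-length-filter p []       = refl
  fromℕ-length-filter p (a ∷ as) with p a
  ... | true  = cong (1ℚ +_) (fromℕ-length-filter p as)
  ... | false = trans (fromℕ-length-filter p as) (sym (ℚₚ.+-identityˡ _))

  count-++ : ∀ (p : A → Bool) xs ys → count p (xs ++ ys) ≡ count p xs + count p ys
  count-++ p []       ys = sym (ℚₚ.+-identityˡ (count p ys))
  count-++ p (a ∷ as) ys = trans (cong (toℚ (p a) +_) (count-++ p as ys)) (sym (ℚₚ.+-assoc (toℚ (p a)) _ _))

  count-cong : ∀ {p q : A → Bool} → p ≗ q → ∀ xs → count p xs ≡ count q xs
  count-cong p≗q []       = refl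
  count-cong p≗q (a ∷ as) = cong₂ _+_ (cong toℚ (p≗q a)) (count-cong p≗q as)

  count-∧ : ∀ b (p : A → Bool) xs → count (λ a → b ∧ p a) xs ≡ toℚ b * count p xs
  count-∧ true  p xs = sym (ℚₚ.*-identityˡ (count p xs))
  count-∧ false p xs = trans (no-hits xs) (sym (ℚₚ.*-zeroˡ (count p xs)))
    where
    no-hits : ∀ xs → count (λ _ → false) xs ≡ 0ℚ
    no-hits []       = refl
    no-hits (_ ∷ as) = trans (ℚₚ.+-identityˡ (count _ as)) (no-hits as)

  count-map : ∀ {B : Set} (p : A → Bool) (f : B → A) xs → count p (map f xs) ≡ count (p ∘ f) xs
  count-map p f []       = refl
  count-map p f (b ∷ bs) = cong (toℚ (p (f b)) +_) (count-map p f bs)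

  count-concatMap : ∀ {B : Set} {n} (p : A → Bool) (g : B → List A) (h : Fin n → B) →
                    count p (concatMap g (tabulate h)) ≡ ∑[ i < n ] count p (g (h i))
  count-concatMap {n = zero}  p g h = refl
  count-concatMap {n = suc n} p g h =
    trans (count-++ p (g (h zero)) _) (cong (count p (g (h zero)) +_) (count-concatMap p g (h ∘ suc)))

T-injective : ∀ {b c} → T b ⇔ T c → b ≡ c
T-injective {true}  {true}  _   = refl
T-injective {true}  {false} b⇔c = ⊥-elim (Equivalence.to b⇔c _)
T-injective {false} {true}  b⇔c = ⊥-elim (Equivalence.from b⇔c _)
T-injective {false} {false} _   = refl

T-not-∨ : ∀ {b c} → T (not b ∨ c) ⇔ (T b → T c)
T-not-∨ {true}  = mk⇔ (λ c _ → c) (λ f → f _)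
T-not-∨ {false} = mk⇔ (λ _ ()) (λ _ → _)

T-all-allFin : ∀ {k} (p : Fin k → Bool) → T (all p (allFin k)) ⇔ (∀ i → T (p i))
T-all-allFin p = mk⇔ (tabulate⁻ ∘ all⁺ p _) (all⁻ p ∘ tabulate⁺)

module _ {k n} (F : Graph k) (G : Graph n) where

  T-isHom : ∀ h → T (isHom F G h) ⇔ (∀ u v → T (adj F u v) → T (adj G (h u) (h v)))
  T-isHom h = mk⇔
    (λ hom u v → Equivalence.to T-not-∨
                   (Equivalence.to (T-all-allFin _) (Equivalence.to (T-all-allFin _) hom u) v))
    (λ hom → Equivalence.from (T-all-allFin _) (λ u → Equivalence.from (T-all-allFin _) (λ v →
               Equivalence.from T-not-∨ (hom u v))))

  isHom-cong : ∀ {h h′} → h ≗ h′ → isHom F G h ≡ isHom F G h′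
  isHom-cong h≗h′ = cong and (map-cong (λ u → cong and (map-cong (λ v →
    cong₂ (λ a b → not (adj F u v) ∨ adj G a b) (h≗h′ u) (h≗h′ v)) (allFin k))) (allFin k))

isHom-P-suc : ∀ {n} (G : Graph n) ℓ (h : Fin (suc (suc ℓ)) → Fin n) →
              isHom (P (suc ℓ)) G h ≡ adj G (h zero) (h (suc zero)) ∧ isHom (P ℓ) G (h ∘ suc)
isHom-P-suc G ℓ h = T-injective (mk⇔ to from)
  where
  to : T (isHom (P (suc ℓ)) G h) → T (adj G (h zero) (h (suc zero)) ∧ isHom (P ℓ) G (h ∘ suc))
  to hom = Equivalence.from T-∧
    (edges zero (suc zero) _ , Equivalence.from (T-isHom (P ℓ) G (h ∘ suc)) (λ u v → edges (suc u) (suc v)))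
    where
    edges = Equivalence.to (T-isHom (P (suc ℓ)) G h) hom
  from : T (adj G (h zero) (h (suc zero)) ∧ isHom (P ℓ) G (h ∘ suc)) → T (isHom (P (suc ℓ)) G h)
  from first∧rest = Equivalence.from (T-isHom (P (suc ℓ)) G h) edges
    where
    first : T (adj G (h zero) (h (suc zero)))
    first = proj₁ (Equivalence.to T-∧ first∧rest)
    rest : ∀ u v → T (adj (P ℓ) u v) → T (adj G (h (suc u)) (h (suc v)))
    rest = Equivalence.to (T-isHom (P ℓ) G (h ∘ suc))
                          (proj₂ (Equivalence.to (T-∧ {adj G (h zero) (h (suc zero))}) first∧rest))
    edges : ∀ u v → T (adj (P (suc ℓ)) u v) → T (adj G (h u) (h v))
    edges zero          zero          ()
    edges zero          (suc zero)    _  = first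
    edges zero          (suc (suc v)) ()
    edges (suc zero)    zero          _  = subst T (symmetric G (h zero) (h (suc zero))) first
    edges (suc (suc u)) zero          ()
    edges (suc u)       (suc v)       uv = rest u v uv

∷ᵥ-cong : ∀ {n k} (x : Fin n) {f g : Fin k → Fin n} → f ≗ g → (x ∷ᵥ f) ≗ (x ∷ᵥ g)
∷ᵥ-cong x f≗g zero    = refl
∷ᵥ-cong x f≗g (suc i) = f≗g i

count-allMaps-suc : ∀ k n (p : (Fin (suc k) → Fin n) → Bool) → (∀ {h h′} → h ≗ h′ → p h ≡ p h′) →
                    count p (allMaps (suc k) n) ≡ ∑[ x < n ] count (λ f → p (x ∷ᵥ f)) (allMaps k n)
count-allMaps-suc k n p p-cong = trans (count-concatMap {n = n} p _ id) (sum-cong-≗ {n} (λ x →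
  trans (count-map p _ (allMaps k n))
        (count-cong (λ f → p-cong (λ { zero → refl ; (suc i) → refl })) (allMaps k n))))

walks : ∀ {n} → Graph n → ℕ → Vector ℚ n
walks {n} G ℓ x = count (λ f → isHom (P ℓ) G (x ∷ᵥ f)) (allMaps ℓ n)

module _ {n} (G : Graph n) where

  walks-suc : ∀ ℓ x → walks G (suc ℓ) x ≡ (G · walks G ℓ) x
  walks-suc ℓ x = begin
    walks G (suc ℓ) x
      ≡⟨ count-allMaps-suc ℓ n _ (isHom-cong (P (suc ℓ)) G ∘ ∷ᵥ-cong x) ⟩
    ∑[ y < n ] count (λ f → isHom (P (suc ℓ)) G (x ∷ᵥ (y ∷ᵥ f))) (allMaps ℓ n)
      ≡⟨ sum-cong-≗ (λ y → count-cong (λ f → isHom-P-suc G ℓ (x ∷ᵥ (y ∷ᵥ f))) (allMaps ℓ n)) ⟩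
    ∑[ y < n ] count (λ f → adj G x y ∧ isHom (P ℓ) G (y ∷ᵥ f)) (allMaps ℓ n)
      ≡⟨ sum-cong-≗ (λ y → count-∧ (adj G x y) _ (allMaps ℓ n)) ⟩
    (G · walks G ℓ) x
      ∎

  walks≗ : ∀ ℓ → walks G ℓ ≗ (G ^ ℓ) ones
  walks≗ zero    x = refl
  walks≗ (suc ℓ) x = trans (walks-suc ℓ x) (·-cong G (walks≗ ℓ) x)

  hom-path : ∀ ℓ → fromℕ (hom (P ℓ) G) ≡ sum ((G ^ ℓ) ones)
  hom-path ℓ = begin
    fromℕ (hom (P ℓ) G)                        ≡⟨ fromℕ-length-filter (isHom (P ℓ) G) (allMaps (suc ℓ) n) ⟩
    count (isHom (P ℓ) G) (allMaps (suc ℓ) n)  ≡⟨ count-allMaps-suc ℓ n (isHom (P ℓ) G) (isHom-cong (P ℓ) G) ⟩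
    sum (walks G ℓ)                            ≡⟨ sum-cong-≗ (walks≗ ℓ) ⟩
    sum ((G ^ ℓ) ones)                         ∎

-- (ii) ⇒ (i)

module _ {n m} (G : Graph n) (H : Graph m) (X : Fin n → Fin m → ℚ) where

  ^-intertwines : (∀ v w → ∑[ u < n ] (A[ G ] v u * X u w) ≡ ∑[ x < m ] (X v x * A[ H ] x w)) →
                  ∀ ℓ y → (G ^ ℓ) (X ⊙ y) ≗ X ⊙ (H ^ ℓ) y
  ^-intertwines AX≡XB zero    y v = refl
  ^-intertwines AX≡XB (suc ℓ) y v = begin
    (G · (G ^ ℓ) (X ⊙ y)) v                             ≡⟨ ·-cong G (^-intertwines AX≡XB ℓ y) v ⟩
    ∑[ u < n ] (A[ G ] v u * ∑[ w < m ] (X u w * z w))  ≡⟨ ∑∑-assoc (A[ G ] v) X z ⟩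
    ∑[ w < m ] (∑[ u < n ] (A[ G ] v u * X u w) * z w)  ≡⟨ sum-cong-≗ (λ w → cong (_* z w) (AX≡XB v w)) ⟩
    ∑[ w < m ] (∑[ x < m ] (X v x * A[ H ] x w) * z w)  ≡⟨ ∑∑-assoc (X v) A[ H ] z ⟨
    (X ⊙ H · z) v                                       ∎
    where
    z = (H ^ ℓ) y

  ⊙-ones : (∀ v → sum (X v) ≡ 1ℚ) → X ⊙ ones ≗ ones
  ⊙-ones rows v = trans (sum-cong-≗ (λ w → ℚₚ.*-identityʳ (X v w))) (rows v)

  sum-⊙ : (∀ w → sum (λ v → X v w) ≡ 1ℚ) → ∀ y → sum (X ⊙ y) ≡ sum y
  sum-⊙ cols y = begin
    sum (X ⊙ y)                                 ≡⟨ ones∙ (X ⊙ y) ⟨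
    ∑[ v < n ] (1ℚ * ∑[ w < m ] (X v w * y w))  ≡⟨ ∑∑-assoc ones X y ⟩
    ∑[ w < m ] (ones ∙ (λ v → X v w) * y w)     ≡⟨ sum-cong-≗ (λ w → cong (_* y w) (trans (ones∙ (λ v → X v w)) (cols w))) ⟩
    ∑[ w < m ] (1ℚ * y w)                       ≡⟨ ones∙ y ⟩
    sum y                                       ∎

  fiso⇒hom-paths : IsFisoSolution G H X → ∀ ℓ → hom (P ℓ) G ≡ hom (P ℓ) H
  fiso⇒hom-paths (AX≡XB , rows , cols) ℓ = fromℕ-injective (begin
    fromℕ (hom (P ℓ) G)       ≡⟨ hom-path G ℓ ⟩
    sum ((G ^ ℓ) ones)        ≡⟨ sum-cong-≗ (^-cong G ℓ (⊙-ones rows′)) ⟨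
    sum ((G ^ ℓ) (X ⊙ ones))  ≡⟨ sum-cong-≗ (^-intertwines AX≡XB′ ℓ ones) ⟩
    sum (X ⊙ (H ^ ℓ) ones)    ≡⟨ sum-⊙ cols′ ((H ^ ℓ) ones) ⟩
    sum ((H ^ ℓ) ones)        ≡⟨ hom-path H ℓ ⟨
    fromℕ (hom (P ℓ) H)       ∎)
    where
    AX≡XB′ : ∀ v w → ∑[ u < n ] (A[ G ] v u * X u w) ≡ ∑[ x < m ] (X v x * A[ H ] x w)
    AX≡XB′ v w = trans (sym (Σℚ≡sum (λ u → A[ G ] v u * X u w)))
                       (trans (AX≡XB v w) (Σℚ≡sum (λ x → X v x * A[ H ] x w)))
    rows′ : ∀ v → sum (X v) ≡ 1ℚ
    rows′ v = trans (sym (Σℚ≡sum (X v))) (rows v)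
    cols′ : ∀ w → sum (λ v → X v w) ≡ 1ℚ
    cols′ w = trans (sym (Σℚ≡sum (λ v → X v w))) (cols w)

-- (i) ⇒ (ii)

module Lanczos {n} (G : Graph n) where

  coefficient : Vector ℚ n → Vector ℚ n → ℚ
  coefficient y x = y ∙ G · x * inv ∥ y ∥²

  -- The coefficients depend on the sequence itself, so it is defined here and only then
  -- identified with the Krylov sequence of its own coefficients (lanczos≡krylov).
  lanczos : ℕ → Vector ℚ n × Vector ℚ n
  α β : ℕ → ℚ
  lanczos zero    = 0ᵥ , ones
  lanczos (suc k) = threeTerm G (α k) (β k) (lanczos k)
  α k = coefficient (proj₂ (lanczos k)) (proj₂ (lanczos k))
  β k = coefficient (proj₁ (lanczos k)) (proj₂ (lanczos k))

  open Krylov G α β ones public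

  lanczos≡krylov : ∀ k → lanczos k ≡ krylov k
  lanczos≡krylov zero    = refl
  lanczos≡krylov (suc k) = cong (threeTerm G (α k) (β k)) (lanczos≡krylov k)

  coefficient-spec : ∀ y x → coefficient y x * ∥ y ∥² ≡ y ∙ G · x
  coefficient-spec y x = *-inv-cancel (∥∥²≡0⇒∙≡0 y (G · x))

  α-spec : ∀ k → α k * ∥ e k ∥² ≡ e k ∙ G · e k
  α-spec k = trans (cong (λ p → coefficient (proj₂ p) (proj₂ p) * ∥ e k ∥²) (lanczos≡krylov k))
                   (coefficient-spec (e k) (e k))

  β-spec : ∀ k → β k * ∥ prev k ∥² ≡ prev k ∙ G · e k
  β-spec k = trans (cong (λ p → coefficient (proj₁ p) (proj₂ p) * ∥ prev k ∥²) (lanczos≡krylov k))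
                   (coefficient-spec (prev k) (e k))

  open Orthogonality α-spec β-spec public

  β-suc : ∀ k → β (suc k) ≡ ∥ e (suc k) ∥² * inv ∥ e k ∥²
  β-suc k = trans (cong (λ p → coefficient (proj₁ p) (proj₂ p)) (lanczos≡krylov (suc k)))
                  (cong (_* inv ∥ e k ∥²) (coupling k))

module Construction {n m} (G : Graph n) (H : Graph m)
  (moments : ∀ ℓ → ones ∙ (G ^ ℓ) ones ≡ ones ∙ (H ^ ℓ) ones) where

  open Lanczos G
  module F = Krylov H α β ones

  f : ℕ → Vector ℚ m
  f = F.e

  gram : ∀ i j ℓ → e i ∙ (G ^ ℓ) (e j) ≡ f i ∙ (H ^ ℓ) (f j)
  gram i j = krylov-moments G H α β ones ones (λ ℓ → begin
    ones ∙ (G ^ ℓ) (e j)  ≡⟨ ^-selfAdjoint G ℓ ones (e j) ⟩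
    (G ^ ℓ) ones ∙ e j    ≡⟨ ∙-comm ((G ^ ℓ) ones) (e j) ⟩
    e j ∙ (G ^ ℓ) ones    ≡⟨ krylov-moments G H α β ones ones moments j ℓ ⟩
    f j ∙ (H ^ ℓ) ones    ≡⟨ ∙-comm (f j) ((H ^ ℓ) ones) ⟩
    (H ^ ℓ) ones ∙ f j    ≡⟨ ^-selfAdjoint H ℓ ones (f j) ⟨
    ones ∙ (H ^ ℓ) (f j)  ∎) i

  ∥e∥²≡∥f∥² : ∀ k → ∥ e k ∥² ≡ ∥ f k ∥²
  ∥e∥²≡∥f∥² k = gram k k 0

  α-specᴴ : ∀ k → α k * ∥ f k ∥² ≡ f k ∙ H · f k
  α-specᴴ k = trans (cong (α k *_) (sym (∥e∥²≡∥f∥² k))) (trans (α-spec k) (gram k k 1))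

  β-specᴴ : ∀ k → β k * ∥ F.prev k ∥² ≡ F.prev k ∙ H · f k
  β-specᴴ zero    = trans (cong (β 0 *_) (∙-zeroˡ (F.prev 0) (F.prev 0) (λ _ → refl)))
                          (trans (ℚₚ.*-zeroʳ (β 0)) (sym (∙-zeroˡ (F.prev 0) (H · f 0) (λ _ → refl))))
  β-specᴴ (suc k) = trans (cong (β (suc k) *_) (sym (∥e∥²≡∥f∥² k))) (trans (β-spec (suc k)) (gram k (suc k) 1))

  module Fᴼ = F.Orthogonality α-specᴴ β-specᴴ

  vanishing : ∃ λ N → ∥ e N ∥² ≡ 0ℚ
  vanishing = orthogonal-sequence-vanishes {g = e} orthogonal

  N : ℕ
  N = proj₁ vanishing

  e-N≗0 : e N ≗ 0ᵥ
  e-N≗0 = ∥∥²≡0⇒≗0 (e N) (proj₂ vanishing)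

  f-N≗0 : f N ≗ 0ᵥ
  f-N≗0 = ∥∥²≡0⇒≗0 (f N) (trans (sym (∥e∥²≡∥f∥² N)) (proj₂ vanishing))

  c : ℕ → ℚ
  c k = inv ∥ e k ∥²

  X : Fin n → Fin m → ℚ
  X v w = ∑[ k < N ] (c (toℕ k) * e (toℕ k) v * f (toℕ k) w)

  -- The k-th term of (AX - XB) v w is D (suc k) - D k.
  module Entry (v : Fin n) (w : Fin m) where

    W : ℕ → ℚ
    W k = e k v * F.prev k w - prev k v * f k w

    D : ℕ → ℚ
    D k = c k * β k * W k

    D-suc : ∀ k → c k * W (suc k) ≡ D (suc k)
    D-suc k = begin
      c k * W (suc k)                                        ≡⟨ *-inv-cancel W-vanishes ⟨
      c k * W (suc k) * inv ∥ e (suc k) ∥² * ∥ e (suc k) ∥²  ≡⟨ reorder (c k) (W (suc k)) (inv ∥ e (suc k) ∥²) _ ⟩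
      c (suc k) * (∥ e (suc k) ∥² * c k) * W (suc k)         ≡⟨ cong (λ b → c (suc k) * b * W (suc k)) (β-suc k) ⟨
      D (suc k)                                              ∎
      where
      reorder : ∀ c W i q → c * W * i * q ≡ i * (q * c) * W
      reorder = solve-∀ ℚ-ring
      vanish : ∀ c E F → c * (0ℚ * F - E * 0ℚ) ≡ 0ℚ
      vanish = solve-∀ ℚ-ring
      W-vanishes : ∥ e (suc k) ∥² ≡ 0ℚ → c k * W (suc k) ≡ 0ℚ
      W-vanishes ∥e∥²≡0 = trans (cong₂ (λ a b → c k * (a * f k w - e k v * b))
                                       (∥∥²≡0⇒≗0 (e (suc k)) ∥e∥²≡0 v)
                                       (∥∥²≡0⇒≗0 (f (suc k)) (trans (sym (∥e∥²≡∥f∥² (suc k))) ∥e∥²≡0) w))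
                                (vanish (c k) (e k v) (f k w))

    step : ∀ k → (G · e k) v * (c k * f k w) ≡ (H · f k) w * (c k * e k v) + (D (suc k) - D k)
    step k = begin
      (G · e k) v * (c k * f k w)
        ≡⟨ cong (_* (c k * f k w)) (·-e k v) ⟩
      (e (suc k) v + α k * e k v + β k * prev k v) * (c k * f k w)
        ≡⟨ exchange (c k) (α k) (β k) (e (suc k) v) (e k v) (prev k v) (f (suc k) w) (f k w) (F.prev k w) ⟩
      (f (suc k) w + α k * f k w + β k * F.prev k w) * (c k * e k v) + (c k * W (suc k) - D k)
        ≡⟨ cong₂ (λ p q → p * (c k * e k v) + (q - D k)) (sym (F.·-e k w)) (D-suc k) ⟩
      (H · f k) w * (c k * e k v) + (D (suc k) - D k)
        ∎
      where
      exchange : ∀ c a b E₁ E₀ Eₚ F₁ F₀ Fₚ →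
        (E₁ + a * E₀ + b * Eₚ) * (c * F₀) ≡
        (F₁ + a * F₀ + b * Fₚ) * (c * E₀) + (c * (E₁ * F₀ - E₀ * F₁) - c * b * (E₀ * Fₚ - Eₚ * F₀))
      exchange = solve-∀ ℚ-ring

    boundary : D N - D 0 ≡ 0ℚ
    boundary = begin
      c N * β N * W N - c 0 * β 0 * W 0
        ≡⟨ cong (λ p → c N * β N * p - c 0 * β 0 * W 0)
                (cong₂ (λ a b → a * F.prev N w - prev N v * b) (e-N≗0 v) (f-N≗0 w)) ⟩
      c N * β N * (0ℚ * F.prev N w - prev N v * 0ℚ) - c 0 * β 0 * (1ℚ * 0ℚ - 0ℚ * 1ℚ)
        ≡⟨ vanish (c N * β N) (c 0 * β 0) (F.prev N w) (prev N v) ⟩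
      0ℚ
        ∎
      where
      vanish : ∀ p q a b → p * (0ℚ * a - b * 0ℚ) - q * (1ℚ * 0ℚ - 0ℚ * 1ℚ) ≡ 0ℚ
      vanish = solve-∀ ℚ-ring

    column : ∀ u → X u w ≡ ∑[ k < N ] (e (toℕ k) u * (c (toℕ k) * f (toℕ k) w))
    column u = sum-cong-≗ {N} (λ k → reorder (c (toℕ k)) (e (toℕ k) u) (f (toℕ k) w))
      where
      reorder : ∀ c E F → c * E * F ≡ E * (c * F)
      reorder = solve-∀ ℚ-ring

    row : ∀ x → X v x ≡ ∑[ k < N ] (f (toℕ k) x * (c (toℕ k) * e (toℕ k) v))
    row x = sum-cong-≗ {N} (λ k → reorder (c (toℕ k)) (e (toℕ k) v) (f (toℕ k) x))
      where
      reorder : ∀ c E F → c * E * F ≡ F * (c * E)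
      reorder = solve-∀ ℚ-ring

    commutes : ∑[ u < n ] (A[ G ] v u * X u w) ≡ ∑[ x < m ] (X v x * A[ H ] x w)
    commutes = begin
      (G · (λ u → X u w)) v
        ≡⟨ ·-cong G column v ⟩
      (G · (λ u → ∑[ k < N ] (e (toℕ k) u * (c (toℕ k) * f (toℕ k) w)))) v
        ≡⟨ ⊙-∑ {N = N} A[ G ] (e ∘ toℕ) (λ k → c (toℕ k) * f (toℕ k) w) v ⟩
      ∑[ k < N ] ((G · e (toℕ k)) v * (c (toℕ k) * f (toℕ k) w))
        ≡⟨ ∑-telescope N (λ k → (G · e k) v * (c k * f k w)) (λ k → (H · f k) w * (c k * e k v)) D step ⟩
      ∑[ k < N ] ((H · f (toℕ k)) w * (c (toℕ k) * e (toℕ k) v)) + (D N - D 0)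
        ≡⟨ trans (cong (∑[ k < N ] ((H · f (toℕ k)) w * (c (toℕ k) * e (toℕ k) v)) +_) boundary)
                 (ℚₚ.+-identityʳ _) ⟩
      ∑[ k < N ] ((H · f (toℕ k)) w * (c (toℕ k) * e (toℕ k) v))
        ≡⟨ ⊙-∑ {N = N} A[ H ] (f ∘ toℕ) (λ k → c (toℕ k) * e (toℕ k) v) w ⟨
      (H · (λ x → ∑[ k < N ] (f (toℕ k) x * (c (toℕ k) * e (toℕ k) v)))) w
        ≡⟨ ·-cong H row w ⟨
      (H · X v) w
        ≡⟨ sum-cong-≗ (λ x → trans (ℚₚ.*-comm (A[ H ] w x) (X v x)) (cong (λ b → X v x * toℚ b) (symmetric H w x))) ⟩
      ∑[ x < m ] (X v x * A[ H ] x w)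
        ∎

  N-positive : ∥ e 0 ∥² ≢ 0ℚ → 0 < N
  N-positive ∥e₀∥²≢0 = ℕₚ.n≢0⇒n>0 (λ N≡0 → ∥e₀∥²≢0 (subst (λ k → ∥ e k ∥² ≡ 0ℚ) N≡0 (proj₂ vanishing)))

  leading : ∥ e 0 ∥² ≢ 0ℚ → c 0 * 1ℚ * ∥ e 0 ∥² ≡ 1ℚ
  leading ∥e₀∥²≢0 = trans (reorder (c 0) ∥ e 0 ∥²) (*-inv-inverse ∥e₀∥²≢0)
    where
    reorder : ∀ c q → c * 1ℚ * q ≡ q * c
    reorder = solve-∀ ℚ-ring

  rows : ∀ v → sum (X v) ≡ 1ℚ
  rows v = begin
    ∑[ w < m ] ∑[ k < N ] (c (toℕ k) * e (toℕ k) v * f (toℕ k) w)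
      ≡⟨ ∑-outer {m} {N} (λ k → c (toℕ k) * e (toℕ k) v) (f ∘ toℕ) ⟩
    ∑[ k < N ] (c (toℕ k) * e (toℕ k) v * sum (f (toℕ k)))
      ≡⟨ ∑-first {N} (N-positive ∥e₀∥²≢0) (λ k → c k * e k v * sum (f k)) later ⟩
    c 0 * 1ℚ * sum (f 0)
      ≡⟨ cong (c 0 * 1ℚ *_) (trans (sym (ones∙ (f 0))) (sym (∥e∥²≡∥f∥² 0))) ⟩
    c 0 * 1ℚ * ∥ e 0 ∥²
      ≡⟨ leading ∥e₀∥²≢0 ⟩
    1ℚ
      ∎
    where
    ∥e₀∥²≢0 : ∥ e 0 ∥² ≢ 0ℚ
    ∥e₀∥²≢0 ∥e₀∥²≡0 = ℚₚ.1≢0 (∥∥²≡0⇒≗0 (e 0) ∥e₀∥²≡0 v)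
    later : ∀ k → 0 < k → c k * e k v * sum (f k) ≡ 0ℚ
    later k 0<k = trans (cong (c k * e k v *_) (trans (sym (ones∙ (f k))) (Fᴼ.orthogonal 0<k)))
                        (ℚₚ.*-zeroʳ (c k * e k v))

  cols : ∀ w → sum (λ v → X v w) ≡ 1ℚ
  cols w = begin
    ∑[ v < n ] ∑[ k < N ] (c (toℕ k) * e (toℕ k) v * f (toℕ k) w)
      ≡⟨ sum-cong-≗ (λ v → sum-cong-≗ {N} (λ k → reorder (c (toℕ k)) (e (toℕ k) v) (f (toℕ k) w))) ⟩
    ∑[ v < n ] ∑[ k < N ] (c (toℕ k) * f (toℕ k) w * e (toℕ k) v)
      ≡⟨ ∑-outer {n} {N} (λ k → c (toℕ k) * f (toℕ k) w) (e ∘ toℕ) ⟩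
    ∑[ k < N ] (c (toℕ k) * f (toℕ k) w * sum (e (toℕ k)))
      ≡⟨ ∑-first {N} (N-positive ∥e₀∥²≢0) (λ k → c k * f k w * sum (e k)) later ⟩
    c 0 * 1ℚ * sum (e 0)
      ≡⟨ cong (c 0 * 1ℚ *_) (sym (ones∙ (e 0))) ⟩
    c 0 * 1ℚ * ∥ e 0 ∥²
      ≡⟨ leading ∥e₀∥²≢0 ⟩
    1ℚ
      ∎
    where
    reorder : ∀ c E F → c * E * F ≡ c * F * E
    reorder = solve-∀ ℚ-ring
    ∥e₀∥²≢0 : ∥ e 0 ∥² ≢ 0ℚ
    ∥e₀∥²≢0 ∥e₀∥²≡0 = ℚₚ.1≢0 (∥∥²≡0⇒≗0 (f 0) (trans (sym (∥e∥²≡∥f∥² 0)) ∥e₀∥²≡0) w)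
    later : ∀ k → 0 < k → c k * f k w * sum (e k) ≡ 0ℚ
    later k 0<k = trans (cong (c k * f k w *_) (trans (sym (ones∙ (e k))) (orthogonal 0<k)))
                        (ℚₚ.*-zeroʳ (c k * f k w))

  solution : IsFisoSolution G H X
  solution = (λ v w → trans (Σℚ≡sum (λ u → A[ G ] v u * X u w))
                            (trans (Entry.commutes v w) (sym (Σℚ≡sum (λ x → X v x * A[ H ] x w)))))
           , (λ v → trans (Σℚ≡sum (X v)) (rows v))
           , (λ w → trans (Σℚ≡sum (λ v → X v w)) (cols w))

hom-paths⇒moments : ∀ {n m} (G : Graph n) (H : Graph m) → (∀ ℓ → hom (P ℓ) G ≡ hom (P ℓ) H) →
                    ∀ ℓ → ones ∙ (G ^ ℓ) ones ≡ ones ∙ (H ^ ℓ) ones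
hom-paths⇒moments G H same ℓ = begin
  ones ∙ (G ^ ℓ) ones  ≡⟨ ones∙ ((G ^ ℓ) ones) ⟩
  sum ((G ^ ℓ) ones)   ≡⟨ hom-path G ℓ ⟨
  fromℕ (hom (P ℓ) G)  ≡⟨ cong fromℕ (same ℓ) ⟩
  fromℕ (hom (P ℓ) H)  ≡⟨ hom-path H ℓ ⟩
  sum ((H ^ ℓ) ones)   ≡⟨ ones∙ ((H ^ ℓ) ones) ⟨
  ones ∙ (H ^ ℓ) ones  ∎

theorem2 : ∀ {n m} (G : Graph n) (H : Graph m) →
    ((ℓ : ℕ) → hom (P ℓ) G ≡ hom (P ℓ) H) ⇔ ∃ (λ (X : Fin n → Fin m → ℚ) → IsFisoSolution G H X)
theorem2 G H = mk⇔
  (λ same → let open Construction G H (hom-paths⇒moments G H same) in X , solution)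
  (λ (X , solution) → fiso⇒hom-paths G H X solution)
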